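{- Let $n\ge1$ and let $t,x_1,\dots,x_n$ be indeterminates. Let $$\Phi=\prod_{i=1}^n\frac{1-tx_i^2}{1-x_i^2}\prod_{1\le i<j\le n}\frac{1-tx_ix_j}{1-x_ix_j},$$ and for $1\le i\le n$ let $T_i$ be the operator on rational functions sending $x_i$ to $1/x_i$ (other variables fixed). Then $$(1+T_1)(1+T_2)\cdots(1+T_n)\,\Phi=\prod_{i=1}^n(t^i+1).$$ -}

module Defs where

open import Data.Nat as ℕ using (ℕ; zero; suc)
open import Data.Fin using (Fin; toℕ)
open import Data.List using (List; []; _∷_)
open import Data.List.Base using (allFin)
open import Data.Vec.Functional using (updateAt)
open import Data.Rational using (ℚ; 0ℚ; 1ℚ; _+_; _*_; _-_; 1/_; ≢-nonZero)
open import Data.Rational.Properties using (_≟_)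
open import Relation.Nullary using (yes; no)

-- Total inverse on ℚ (value 0 at 0); only ever used at nonzero arguments
-- under the hypotheses of the statement.
inv : ℚ → ℚ
inv p with p ≟ 0ℚ
... | yes _ = 0ℚ
... | no p≢0 = 1/_ p {{≢-nonZero p≢0}}

pow : ℚ → ℕ → ℚ
pow q zero = 1ℚ
pow q (suc k) = q * pow q k

prodFin : (n : ℕ) → (Fin n → ℚ) → ℚ
prodFin zero f = 1ℚ
prodFin (suc n) f = f Fin.zero * prodFin n (λ i → f (Fin.suc i))
  where import Data.Fin as Fin

prodPairs : (n : ℕ) → (Fin n → Fin n → ℚ) → ℚ
prodPairs n f = prodFin n (λ i → prodFin n (λ j → g i j))
  where
  g : Fin n → Fin n → ℚ
  g i j with toℕ i ℕ.<? toℕ j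
  ... | yes _ = f i j
  ... | no _ = 1ℚ

Φ : (n : ℕ) → ℚ → (Fin n → ℚ) → ℚ
Φ n t x =
  prodFin n (λ i → (1ℚ - t * (x i * x i)) * inv (1ℚ - x i * x i))
  * prodPairs n (λ i j → (1ℚ - t * (x i * x j)) * inv (1ℚ - x i * x j))

Fun : ℕ → Set
Fun n = (Fin n → ℚ) → ℚ

T : {n : ℕ} → Fin n → Fun n → Fun n
T i F x = F (updateAt x i inv)

onePlusT : {n : ℕ} → Fin n → Fun n → Fun n
onePlusT i F x = F x + T i F x

applyAll : {n : ℕ} → List (Fin n) → Fun n → Fun n
applyAll [] F = F
applyAll (i ∷ is) F = onePlusT i (applyAll is F)

rhs : ℕ → ℚ → ℚ
rhs n t = prodFin n (λ i → pow t (suc (toℕ i)) + 1ℚ)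

{-# OPTIONS --safe #-}
-- Write f(z) = (1 - t z)/(1 - z) = t + (1 - t)/(1 - z) and split off the first variable y = x₁:
-- Φ(y, x₂, …, xₙ) = R(y) Φ(x₂, …, xₙ) with R(y) = f(y²) ∏ₖ f(y xₖ). Multiplying in the factors
-- f(y xₖ) one at a time gives the partial-fraction expansion
--   R(y) = tⁿ + p₊/(1 - y) + p₋/(1 + y) + Σₖ cₖ/(1 - xₖ y),
-- where cₖ = (1 - t) Rₖ(1/xₖ) and Rₖ is R with the factor f(y xₖ) removed. Since
-- 1/(1 - b y) + 1/(1 - b/y) = 1 + h_b(y) with h_{1/b} = -h_b (so h_{±1} = 0), and R(0) = 1,
--   R(y) + R(1/y) = tⁿ + 1 + Σₖ cₖ h_{xₖ}(y).
-- The product cₖ Φ(x₂, …, xₙ) = (1 - t) Rₖ(1/xₖ) Rₖ(xₖ) Φ(x₂, …, x̂ₖ, …, xₙ) is invariant under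
-- xₖ ↦ 1/xₖ, so the k-th summand is odd under T_k and is annihilated by (1 + T_k). As T₁ commutes
-- with the other T_k, the left-hand side is (1 + T₂)⋯(1 + Tₙ) applied to
-- Φ + T₁Φ = (tⁿ + 1) Φ(x₂, …, xₙ) + (odd terms), and induction on n finishes the proof.
module Submission where

open import Defs
open import Level using (0ℓ)
open import Data.Nat as ℕ using (ℕ; zero; suc; _≤_)
open import Data.Fin using (Fin; zero; suc; toℕ; punchIn)
import Data.Fin.Properties as Fin
open import Data.Rational using (ℚ; 0ℚ; 1ℚ; ½; _+_; _*_; _-_; -_; ≢-nonZero)
open import Data.Rational.Properties
  using ( _≟_; 1≢0; +-*-commutativeRing; *-1-commutativeMonoid; +-0-commutativeMonoid; *-inverseˡ; *-assoc; *-comm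
        ; *-identityˡ; *-identityʳ; *-zeroˡ; *-zeroʳ; +-identityʳ; +-inverseʳ; *-distribˡ-+; *-distribʳ-+
        ; neg-distrib-+; neg-distribˡ-* )
open import Algebra.Bundles using (CommutativeRing; CommutativeMonoid)
open import Algebra.Properties.Group (CommutativeRing.+-group +-*-commutativeRing) using (x∙y⁻¹≈ε⇒x≈y)
open import Tactic.RingSolver.Core.AlmostCommutativeRing using (AlmostCommutativeRing; fromCommutativeRing)
open import Tactic.RingSolver using (solve)
open import Data.Vec.Functional using (Vector; head; tail; updateAt; removeAt; init; last) renaming (_∷_ to _◂_)
open import Data.Vec.Functional.Properties using (updateAt-updates; updateAt-minimal; updateAt-commutes)
open import Algebra.Properties.Semiring.Sum (CommutativeRing.semiring +-*-commutativeRing)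
  using (sum; sum-cong-≗; ∑-distrib-+; *-distribˡ-sum; *-distribʳ-sum; sum-replicate-zero)
import Algebra.Properties.CommutativeMonoid.Sum as MonoidSum
import Algebra.Properties.CommutativeSemigroup as SemigroupProperties
open import Data.List as List using (List; []; _∷_; allFin)
open import Data.List.Properties using (map-tabulate)
open import Data.List.Relation.Unary.Any using (here; there)
open import Data.List.Membership.Propositional using (_∈_)
open import Data.List.Membership.Propositional.Properties using (∈-allFin)
open import Data.Product using (Σ-syntax; _×_; _,_; proj₁; proj₂)
open import Function using (_∘_; id)
open import Relation.Nullary using (Dec; yes; no; does)
open import Relation.Nullary.Decidable using (dec⇒maybe)
open import Relation.Nullary.Negation using (contradiction)
open import Relation.Binary.PropositionalEquality
  using (_≡_; _≢_; _≗_; refl; sym; trans; cong; cong₂; subst; subst₂; module ≡-Reasoning)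

module ∏ = MonoidSum *-1-commutativeMonoid
module *-CS = SemigroupProperties (CommutativeMonoid.commutativeSemigroup *-1-commutativeMonoid)
module +-CS = SemigroupProperties (CommutativeMonoid.commutativeSemigroup +-0-commutativeMonoid)

open ≡-Reasoning

ℚ-ring : AlmostCommutativeRing 0ℓ 0ℓ
ℚ-ring = fromCommutativeRing +-*-commutativeRing (λ q → dec⇒maybe (0ℚ ≟ q))

private
  variable
    m n : ℕ

inv-inverseˡ : ∀ {p} → p ≢ 0ℚ → inv p * p ≡ 1ℚ
inv-inverseˡ {p} p≢0 with p ≟ 0ℚ
... | yes p≡0 = contradiction p≡0 p≢0
... | no p≢0′ = *-inverseˡ p {{≢-nonZero p≢0′}}

inv-inverseʳ : ∀ {p} → p ≢ 0ℚ → p * inv p ≡ 1ℚ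
inv-inverseʳ {p} p≢0 = trans (*-comm p (inv p)) (inv-inverseˡ p≢0)

inv-unique : ∀ {q} p → p * q ≡ 1ℚ → inv p ≡ q
inv-unique {q} p pq≡1 = begin
  inv p            ≡⟨ *-identityʳ (inv p) ⟨
  inv p * 1ℚ       ≡⟨ cong (inv p *_) pq≡1 ⟨
  inv p * (p * q)  ≡⟨ *-assoc (inv p) p q ⟨
  inv p * p * q    ≡⟨ cong (_* q) (inv-inverseˡ p≢0) ⟩
  1ℚ * q           ≡⟨ *-identityˡ q ⟩
  q                ∎
  where
  p≢0 : p ≢ 0ℚ
  p≢0 refl = 1≢0 (trans (sym pq≡1) (*-zeroˡ q))

inv-involutive : ∀ p → inv (inv p) ≡ p
inv-involutive p = byCases (p ≟ 0ℚ)
  where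
  byCases : Dec (p ≡ 0ℚ) → inv (inv p) ≡ p
  byCases (yes refl) = refl
  byCases (no p≢0) = inv-unique (inv p) (inv-inverseˡ p≢0)

inv-≢0 : ∀ {p} → p ≢ 0ℚ → inv p ≢ 0ℚ
inv-≢0 {p} p≢0 inv-p≡0 = 1≢0 (begin
  1ℚ         ≡⟨ inv-inverseˡ p≢0 ⟨
  inv p * p  ≡⟨ cong (_* p) inv-p≡0 ⟩
  0ℚ * p     ≡⟨ *-zeroˡ p ⟩
  0ℚ         ∎)

inv[p]*q≡1⇒q≡p : ∀ {p q} → p ≢ 0ℚ → inv p * q ≡ 1ℚ → q ≡ p
inv[p]*q≡1⇒q≡p {p} {q} p≢0 p⁻¹q≡1 = begin
  q                ≡⟨ *-identityˡ q ⟨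
  1ℚ * q           ≡⟨ cong (_* q) (inv-inverseʳ p≢0) ⟨
  p * inv p * q    ≡⟨ *-assoc p (inv p) q ⟩
  p * (inv p * q)  ≡⟨ cong (p *_) p⁻¹q≡1 ⟩
  p * 1ℚ           ≡⟨ *-identityʳ p ⟩
  p                ∎

p≢q⇒p-q≢0 : ∀ {p q : ℚ} → p ≢ q → p - q ≢ 0ℚ
p≢q⇒p-q≢0 {p} {q} p≢q = p≢q ∘ x∙y⁻¹≈ε⇒x≈y p q

p≢1⇒1-p≢0 : ∀ {p} → p ≢ 1ℚ → 1ℚ - p ≢ 0ℚ
p≢1⇒1-p≢0 p≢1 = p≢q⇒p-q≢0 (p≢1 ∘ sym)

0*p≢1 : ∀ p → 0ℚ * p ≢ 1ℚ
0*p≢1 p 0p≡1 = 1≢0 (trans (sym 0p≡1) (*-zeroˡ p))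

pole : ℚ → ℚ → ℚ
pole b y = inv (1ℚ - y * b)

pole-inverse : ∀ b y → y * b ≢ 1ℚ → pole b y * (1ℚ - y * b) ≡ 1ℚ
pole-inverse b y yb≢1 = inv-inverseˡ (p≢1⇒1-p≢0 yb≢1)

pole-at-0 : ∀ b → pole b 0ℚ ≡ 1ℚ
pole-at-0 b = cong (λ z → inv (1ℚ - z)) (*-zeroˡ b)

pole-reflect-identity : ∀ y b y⁻¹ b⁻¹ U → y⁻¹ * y ≡ 1ℚ → b⁻¹ * b ≡ 1ℚ → U * (1ℚ - y * b) ≡ 1ℚ →
                        (1ℚ - y⁻¹ * b⁻¹) * (1ℚ - U) ≡ 1ℚ
pole-reflect-identity y b y⁻¹ b⁻¹ U hy hb hU = begin
  (1ℚ - y⁻¹ * b⁻¹) * (1ℚ - U)                ≡⟨ cong (λ e → (1ℚ - y⁻¹ * b⁻¹) * (e - U)) hU ⟨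
  (1ℚ - y⁻¹ * b⁻¹) * (U * (1ℚ - y * b) - U)  ≡⟨ solve (y ∷ b ∷ y⁻¹ ∷ b⁻¹ ∷ U ∷ []) ℚ-ring ⟩
  U * (y⁻¹ * y) * (b⁻¹ * b) - U * (y * b)    ≡⟨ cong₂ (λ p q → U * p * q - U * (y * b)) hy hb ⟩
  U * 1ℚ * 1ℚ - U * (y * b)                  ≡⟨ solve (y ∷ b ∷ U ∷ []) ℚ-ring ⟩
  U * (1ℚ - y * b)                           ≡⟨ hU ⟩
  1ℚ                                         ∎

pole-reflect : ∀ b y → b ≢ 0ℚ → y ≢ 0ℚ → y * b ≢ 1ℚ → pole (inv b) (inv y) ≡ 1ℚ - pole b y
pole-reflect b y b≢0 y≢0 yb≢1 = inv-unique (1ℚ - inv y * inv b)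
  (pole-reflect-identity y b (inv y) (inv b) (pole b y) (inv-inverseˡ y≢0) (inv-inverseˡ b≢0) (pole-inverse b y yb≢1))

partialFractions-identity : ∀ y a b Ua Ub D → Ua * (1ℚ - y * a) ≡ 1ℚ → Ub * (1ℚ - y * b) ≡ 1ℚ →
                            D * (b - a) ≡ 1ℚ → Ua * Ub ≡ b * D * Ub + - (a * D) * Ua
partialFractions-identity y a b Ua Ub D ha hb hD = begin
  Ua * Ub
    ≡⟨ solve (Ua ∷ Ub ∷ []) ℚ-ring ⟩
  Ua * Ub * 1ℚ
    ≡⟨ cong (Ua * Ub *_) hD ⟨
  Ua * Ub * (D * (b - a))
    ≡⟨ solve (y ∷ a ∷ b ∷ Ua ∷ Ub ∷ D ∷ []) ℚ-ring ⟩
  b * D * Ub * (Ua * (1ℚ - y * a)) - a * D * Ua * (Ub * (1ℚ - y * b))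
    ≡⟨ cong₂ (λ p q → b * D * Ub * p - a * D * Ua * q) ha hb ⟩
  b * D * Ub * 1ℚ - a * D * Ua * 1ℚ
    ≡⟨ solve (a ∷ b ∷ Ua ∷ Ub ∷ D ∷ []) ℚ-ring ⟩
  b * D * Ub + - (a * D) * Ua
    ∎

pole-at-reciprocalˡ : ∀ a b b⁻¹ D → b⁻¹ * b ≡ 1ℚ → D * (b - a) ≡ 1ℚ → pole a b⁻¹ ≡ b * D
pole-at-reciprocalˡ a b b⁻¹ D hb hD = inv-unique (1ℚ - b⁻¹ * a) (begin
  (1ℚ - b⁻¹ * a) * (b * D)   ≡⟨ solve (a ∷ b ∷ b⁻¹ ∷ D ∷ []) ℚ-ring ⟩
  (b - b⁻¹ * b * a) * D      ≡⟨ cong (λ e → (b - e * a) * D) hb ⟩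
  (b - 1ℚ * a) * D           ≡⟨ solve (a ∷ b ∷ D ∷ []) ℚ-ring ⟩
  D * (b - a)                ≡⟨ hD ⟩
  1ℚ                         ∎)

pole-at-reciprocalʳ : ∀ a b a⁻¹ D → a⁻¹ * a ≡ 1ℚ → D * (b - a) ≡ 1ℚ → pole b a⁻¹ ≡ - (a * D)
pole-at-reciprocalʳ a b a⁻¹ D ha hD = inv-unique (1ℚ - a⁻¹ * b) (begin
  (1ℚ - a⁻¹ * b) * - (a * D)   ≡⟨ solve (a ∷ b ∷ a⁻¹ ∷ D ∷ []) ℚ-ring ⟩
  (a⁻¹ * a * b - a) * D        ≡⟨ cong (λ e → (e * b - a) * D) ha ⟩
  (1ℚ * b - a) * D             ≡⟨ solve (a ∷ b ∷ D ∷ []) ℚ-ring ⟩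
  D * (b - a)                  ≡⟨ hD ⟩
  1ℚ                           ∎)

partialFractions : ∀ a b y → a ≢ 0ℚ → b ≢ 0ℚ → a ≢ b → y * a ≢ 1ℚ → y * b ≢ 1ℚ →
                   pole a y * pole b y ≡ pole a (inv b) * pole b y + pole b (inv a) * pole a y
partialFractions a b y a≢0 b≢0 a≢b ya≢1 yb≢1 = begin
  pole a y * pole b y
    ≡⟨ partialFractions-identity y a b (pole a y) (pole b y) D (pole-inverse a y ya≢1) (pole-inverse b y yb≢1) D[b-a]≡1 ⟩
  b * D * pole b y + - (a * D) * pole a y
    ≡⟨ cong₂ (λ p q → p * pole b y + q * pole a y)
             (pole-at-reciprocalˡ a b (inv b) D (inv-inverseˡ b≢0) D[b-a]≡1)
             (pole-at-reciprocalʳ a b (inv a) D (inv-inverseˡ a≢0) D[b-a]≡1) ⟨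
  pole a (inv b) * pole b y + pole b (inv a) * pole a y
    ∎
  where
  D : ℚ
  D = inv (b - a)
  D[b-a]≡1 : D * (b - a) ≡ 1ℚ
  D[b-a]≡1 = inv-inverseˡ (p≢q⇒p-q≢0 (a≢b ∘ sym))

inv[1-y²]-identity : ∀ y U₊ U₋ → U₊ * (1ℚ - y * 1ℚ) ≡ 1ℚ → U₋ * (1ℚ - y * - 1ℚ) ≡ 1ℚ →
                     (1ℚ - y * y) * (½ * U₊ + ½ * U₋) ≡ 1ℚ
inv[1-y²]-identity y U₊ U₋ h₊ h₋ = begin
  (1ℚ - y * y) * (½ * U₊ + ½ * U₋)
    ≡⟨ solve (y ∷ U₊ ∷ U₋ ∷ []) ℚ-ring ⟩
  ½ * (1ℚ - y * - 1ℚ) * (U₊ * (1ℚ - y * 1ℚ)) + ½ * (1ℚ - y * 1ℚ) * (U₋ * (1ℚ - y * - 1ℚ))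
    ≡⟨ cong₂ (λ p q → ½ * (1ℚ - y * - 1ℚ) * p + ½ * (1ℚ - y * 1ℚ) * q) h₊ h₋ ⟩
  ½ * (1ℚ - y * - 1ℚ) * 1ℚ + ½ * (1ℚ - y * 1ℚ) * 1ℚ
    ≡⟨ solve (y ∷ []) ℚ-ring ⟩
  1ℚ  ∎

defect : ℚ → ℚ → ℚ
defect b y = pole b y + pole b (inv y) - 1ℚ

defect-reflect : ∀ b y → b ≢ 0ℚ → y ≢ 0ℚ → y * b ≢ 1ℚ → inv y * b ≢ 1ℚ → defect (inv b) y ≡ - defect b y
defect-reflect b y b≢0 y≢0 yb≢1 y⁻¹b≢1 = begin
  pole (inv b) y + pole (inv b) (inv y) - 1ℚ
    ≡⟨ cong₂ (λ p q → p + q - 1ℚ) pole[b⁻¹,y] (pole-reflect b y b≢0 y≢0 yb≢1) ⟩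
  (1ℚ - pole b (inv y)) + (1ℚ - pole b y) - 1ℚ
    ≡⟨ rearrange (pole b y) (pole b (inv y)) ⟩
  - defect b y
    ∎
  where
  pole[b⁻¹,y] : pole (inv b) y ≡ 1ℚ - pole b (inv y)
  pole[b⁻¹,y] = trans (cong (pole (inv b)) (sym (inv-involutive y))) (pole-reflect b (inv y) b≢0 (inv-≢0 y≢0) y⁻¹b≢1)
  rearrange : ∀ p q → (1ℚ - q) + (1ℚ - p) - 1ℚ ≡ - (p + q - 1ℚ)
  rearrange p q = solve (p ∷ q ∷ []) ℚ-ring

defect-self-reciprocal : ∀ b y → inv b ≡ b → b ≢ 0ℚ → y ≢ 0ℚ → y * b ≢ 1ℚ → defect b y ≡ 0ℚ
defect-self-reciprocal b y b⁻¹≡b b≢0 y≢0 yb≢1 = begin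
  pole b y + pole b (inv y) - 1ℚ  ≡⟨ cong (λ p → pole b y + p - 1ℚ) pole[b,y⁻¹] ⟩
  pole b y + (1ℚ - pole b y) - 1ℚ ≡⟨ cancel (pole b y) ⟩
  0ℚ                              ∎
  where
  pole[b,y⁻¹] : pole b (inv y) ≡ 1ℚ - pole b y
  pole[b,y⁻¹] = trans (cong (λ c → pole c (inv y)) (sym b⁻¹≡b)) (pole-reflect b y b≢0 y≢0 yb≢1)
  cancel : ∀ p → p + (1ℚ - p) - 1ℚ ≡ 0ℚ
  cancel p = solve (p ∷ []) ℚ-ring

poleSum : Vector ℚ m → Vector ℚ m → ℚ → ℚ
poleSum c b y = sum (λ k → c k * pole (b k) y)

poleSum-at-0 : ∀ (c b : Vector ℚ m) → poleSum c b 0ℚ ≡ sum c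
poleSum-at-0 c b = sum-cong-≗ (λ k → trans (cong (c k *_) (pole-at-0 (b k))) (*-identityʳ (c k)))

poleSum-symmetrization : ∀ (c b : Vector ℚ m) y →
                         poleSum c b y + poleSum c b (inv y) ≡ sum c + sum (λ k → c k * defect (b k) y)
poleSum-symmetrization c b y = begin
  poleSum c b y + poleSum c b (inv y)                        ≡⟨ ∑-distrib-+ (λ k → c k * pole (b k) y) _ ⟨
  sum (λ k → c k * pole (b k) y + c k * pole (b k) (inv y))  ≡⟨ sum-cong-≗ (λ k → split (c k) (pole (b k) y) _) ⟩
  sum (λ k → c k + c k * defect (b k) y)                     ≡⟨ ∑-distrib-+ c _ ⟩
  sum c + sum (λ k → c k * defect (b k) y)                   ∎
  where
  split : ∀ c p q → c * p + c * q ≡ c + c * (p + q - 1ℚ)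
  split c p q = solve (c ∷ p ∷ q ∷ []) ℚ-ring

symmetrization-identity : ∀ C S₁ S₁′ S₂ S₂′ P Q D → S₁ + S₁′ ≡ P → S₂ + S₂′ ≡ Q + D → C + P + Q ≡ 1ℚ →
                          (C + S₁ + S₂) + (C + S₁′ + S₂′) ≡ C + 1ℚ + D
symmetrization-identity C S₁ S₁′ S₂ S₂′ P Q D h₁ h₂ h₀ = begin
  (C + S₁ + S₂) + (C + S₁′ + S₂′)   ≡⟨ solve (C ∷ S₁ ∷ S₁′ ∷ S₂ ∷ S₂′ ∷ []) ℚ-ring ⟩
  C + (S₁ + S₁′) + (S₂ + S₂′) + C   ≡⟨ cong₂ (λ p q → C + p + q + C) h₁ h₂ ⟩
  C + P + (Q + D) + C               ≡⟨ solve (C ∷ P ∷ Q ∷ D ∷ []) ℚ-ring ⟩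
  C + P + Q + C + D                 ≡⟨ cong (λ e → e + C + D) h₀ ⟩
  1ℚ + C + D                        ≡⟨ solve (C ∷ D ∷ []) ℚ-ring ⟩
  C + 1ℚ + D                        ∎

signs : Vector ℚ 2
signs zero = 1ℚ
signs (suc zero) = - 1ℚ

signs-self-reciprocal : ∀ k → inv (signs k) ≡ signs k
signs-self-reciprocal zero = refl
signs-self-reciprocal (suc zero) = refl

signs-square : ∀ k → signs k * signs k ≡ 1ℚ
signs-square zero = refl
signs-square (suc zero) = refl

signs-≢0 : ∀ k → signs k ≢ 0ℚ
signs-≢0 zero ()
signs-≢0 (suc zero) ()

Regular : ℚ → Set
Regular a = a ≢ 0ℚ × a * a ≢ 1ℚ

Apart : ℚ → ℚ → Set
Apart a b = a * b ≢ 1ℚ × a ≢ b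

Generic : Vector ℚ m → Set
Generic w = (∀ k → Regular (w k)) × (∀ j k → j ≢ k → w j ≢ w k)

Admissible : Vector ℚ m → Set
Admissible x = (∀ i → Regular (x i)) × (∀ i j → i ≢ j → Apart (x i) (x j))

AvoidsPoles : Vector ℚ m → ℚ → Set
AvoidsPoles w y = (∀ k → y * signs k ≢ 1ℚ) × (∀ k → y * w k ≢ 1ℚ)

signs-≢-regular : ∀ {p} → Regular p → ∀ k → signs k ≢ p
signs-≢-regular (_ , p²≢1) k refl = p²≢1 (signs-square k)

*-signs-≢1 : ∀ {p} → Regular p → ∀ k → p * signs k ≢ 1ℚ
*-signs-≢1 {p} regular k ps≡1 = signs-≢-regular regular k (sym (begin
  p                        ≡⟨ *-identityʳ p ⟨
  p * 1ℚ                   ≡⟨ cong (p *_) (signs-square k) ⟨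
  p * (signs k * signs k)  ≡⟨ *-assoc p (signs k) (signs k) ⟨
  p * signs k * signs k    ≡⟨ cong (_* signs k) ps≡1 ⟩
  1ℚ * signs k             ≡⟨ *-identityˡ (signs k) ⟩
  signs k                  ∎))

Regular-inv : ∀ {p} → Regular p → Regular (inv p)
Regular-inv {p} (p≢0 , p²≢1) = inv-≢0 p≢0 , p²≢1 ∘ square≡1
  where
  square≡1 : inv p * inv p ≡ 1ℚ → p * p ≡ 1ℚ
  square≡1 e = trans (cong (p *_) (trans (sym (inv-involutive p)) (inv-unique (inv p) e))) (inv-inverseʳ p≢0)

Apart-sym : ∀ {p q} → Apart p q → Apart q p
Apart-sym {p} {q} (pq≢1 , p≢q) = pq≢1 ∘ trans (*-comm p q) , p≢q ∘ sym

Apart-inv : ∀ {p q} → Apart p q → Apart (inv p) q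
Apart-inv {p} {q} (pq≢1 , p≢q) = byCases (p ≟ 0ℚ)
  where
  byCases : Dec (p ≡ 0ℚ) → Apart (inv p) q
  byCases (yes refl) = pq≢1 , p≢q
  byCases (no p≢0) = p≢q ∘ sym ∘ inv[p]*q≡1⇒q≡p p≢0
                   , λ p⁻¹≡q → pq≢1 (trans (cong (p *_) (sym p⁻¹≡q)) (inv-inverseʳ p≢0))

Admissible⇒Generic : {x : Vector ℚ m} → Admissible x → Generic x
Admissible⇒Generic (regular , apart) = regular , λ i j i≢j → proj₂ (apart i j i≢j)

Generic-tail : {w : Vector ℚ (suc m)} → Generic w → Generic (tail w)
Generic-tail (regular , injective) = regular ∘ suc , λ j k j≢k → injective (suc j) (suc k) (j≢k ∘ Fin.suc-injective)

Admissible-tail : {x : Vector ℚ (suc m)} → Admissible x → Admissible (tail x)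
Admissible-tail (regular , apart) = regular ∘ suc , λ i j i≢j → apart (suc i) (suc j) (i≢j ∘ Fin.suc-injective)

Admissible-resp-≗ : {x x′ : Vector ℚ m} → x ≗ x′ → Admissible x → Admissible x′
Admissible-resp-≗ x≗x′ (regular , apart) =
  (λ i → subst Regular (x≗x′ i) (regular i)) , λ i j i≢j → subst₂ Apart (x≗x′ i) (x≗x′ j) (apart i j i≢j)

avoidsPoles : ∀ {p} {v : Vector ℚ m} → Regular p → (∀ k → Apart p (v k)) → AvoidsPoles v p
avoidsPoles regular apart = *-signs-≢1 regular , proj₁ ∘ apart

module _ {A : Set} {g : A → A} where

  updateAt-preserves : {P : A → Set} → (∀ {a} → P a → P (g a)) →
                       (xs : Vector A n) → (∀ i → P (xs i)) → ∀ k i → P (updateAt xs k g i)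
  updateAt-preserves {P = P} pg xs all k i with i Fin.≟ k
  ... | yes refl = subst P (sym (updateAt-updates i xs)) (pg (all i))
  ... | no i≢k = subst P (sym (updateAt-minimal i k xs i≢k)) (all i)

  updateAt-preserves-pairwise : {R : A → A → Set} → (∀ {a b} → R a b → R b a) → (∀ {a b} → R a b → R (g a) b) →
                                (xs : Vector A n) → (∀ i j → i ≢ j → R (xs i) (xs j)) →
                                ∀ k i j → i ≢ j → R (updateAt xs k g i) (updateAt xs k g j)
  updateAt-preserves-pairwise {R = R} symm rg xs rel k i j i≢j with i Fin.≟ k | j Fin.≟ k
  ... | yes refl | yes refl = contradiction refl i≢j
  ... | yes refl | no j≢k =
    subst₂ R (sym (updateAt-updates i xs)) (sym (updateAt-minimal j i xs j≢k)) (rg (rel i j i≢j))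
  ... | no i≢k | yes refl =
    subst₂ R (sym (updateAt-minimal i j xs i≢k)) (sym (updateAt-updates j xs)) (symm (rg (symm (rel i j i≢j))))
  ... | no i≢k | no j≢k =
    subst₂ R (sym (updateAt-minimal i k xs i≢k)) (sym (updateAt-minimal j k xs j≢k)) (rel i j i≢j)

Admissible-updateAt : {x : Vector ℚ m} → ∀ k → Admissible x → Admissible (updateAt x k inv)
Admissible-updateAt {x = x} k (regular , apart) =
  updateAt-preserves {P = Regular} Regular-inv x regular k
  , updateAt-preserves-pairwise {R = Apart} Apart-sym Apart-inv x apart k

prodFin≡∏ : ∀ n (f : Vector ℚ n) → prodFin n f ≡ ∏.sum f
prodFin≡∏ zero f = refl
prodFin≡∏ (suc n) f = cong (f zero *_) (prodFin≡∏ n (f ∘ suc))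

prodFin-cong : {f g : Vector ℚ n} → f ≗ g → prodFin n f ≡ prodFin n g
prodFin-cong {n} {f} {g} f≗g = begin
  prodFin n f ≡⟨ prodFin≡∏ n f ⟩
  ∏.sum f     ≡⟨ ∏.sum-cong-≗ f≗g ⟩
  ∏.sum g     ≡⟨ prodFin≡∏ n g ⟨
  prodFin n g ∎

prodFin-removeAt : ∀ n (f : Vector ℚ (suc n)) k → prodFin (suc n) f ≡ f k * prodFin n (removeAt f k)
prodFin-removeAt n f k = begin
  prodFin (suc n) f            ≡⟨ prodFin≡∏ (suc n) f ⟩
  ∏.sum f                      ≡⟨ ∏.sum-remove {i = k} f ⟩
  f k * ∏.sum (removeAt f k)   ≡⟨ cong (f k *_) (prodFin≡∏ n (removeAt f k)) ⟨
  f k * prodFin n (removeAt f k) ∎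

prodFin-init-last : ∀ n (f : Vector ℚ (suc n)) → prodFin (suc n) f ≡ prodFin n (init f) * last f
prodFin-init-last n f = begin
  prodFin (suc n) f            ≡⟨ prodFin≡∏ (suc n) f ⟩
  ∏.sum f                      ≡⟨ ∏.sum-init-last f ⟩
  ∏.sum (init f) * last f      ≡⟨ cong (_* last f) (prodFin≡∏ n (init f)) ⟨
  prodFin n (init f) * last f  ∎

prodFin-ones : {f : Vector ℚ n} → (∀ k → f k ≡ 1ℚ) → prodFin n f ≡ 1ℚ
prodFin-ones {n} f≡1 = trans (prodFin-cong f≡1) (trans (prodFin≡∏ n _) (∏.sum-replicate-zero n))

head-◂-tail : (x : Vector ℚ (suc n)) → x ≗ head x ◂ tail x
head-◂-tail x zero = refl
head-◂-tail x (suc i) = refl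

removeAt-suc : (w : Vector ℚ (suc (suc n))) → ∀ k → removeAt w (suc k) ≗ head w ◂ removeAt (tail w) k
removeAt-suc w k zero = refl
removeAt-suc w k (suc j) = refl

removeAt-updateAt : (w : Vector ℚ (suc n)) → ∀ k → removeAt (updateAt w k inv) k ≗ removeAt w k
removeAt-updateAt w k j = updateAt-minimal (punchIn k j) k w (Fin.punchInᵢ≢i k j)

updateAt-suc : ∀ y (v : Vector ℚ n) k → updateAt (y ◂ v) (suc k) inv ≗ y ◂ updateAt v k inv
updateAt-suc y v k zero = refl
updateAt-suc y v k (suc j) = refl

updateAt-resp-≗ : ∀ (k : Fin n) {x x′ : Vector ℚ n} → x ≗ x′ → updateAt x k inv ≗ updateAt x′ k inv
updateAt-resp-≗ zero x≗x′ zero = cong inv (x≗x′ zero)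
updateAt-resp-≗ zero x≗x′ (suc j) = x≗x′ (suc j)
updateAt-resp-≗ (suc k) x≗x′ zero = x≗x′ zero
updateAt-resp-≗ (suc k) x≗x′ (suc j) = updateAt-resp-≗ k (x≗x′ ∘ suc) j

updateAt-comm : ∀ (j k : Fin n) x → updateAt (updateAt x k inv) j inv ≗ updateAt (updateAt x j inv) k inv
updateAt-comm j k x with j Fin.≟ k
... | yes refl = λ _ → refl
... | no j≢k = updateAt-commutes j k j≢k x

Extensional : Fun n → Set
Extensional F = ∀ {x x′} → x ≗ x′ → F x ≡ F x′

Closed : (Vector ℚ n → Set) → Set
Closed V = ∀ i {x} → V x → V (updateAt x i inv)

module _ {n : ℕ} where

  applyAll-extensional : ∀ is {F : Fun n} → Extensional F → Extensional (applyAll is F)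
  applyAll-extensional [] ext x≗x′ = ext x≗x′
  applyAll-extensional (i ∷ is) ext x≗x′ =
    cong₂ _+_ (applyAll-extensional is ext x≗x′) (applyAll-extensional is ext (updateAt-resp-≗ i x≗x′))

  applyAll-cong-on : {V : Vector ℚ n → Set} {F G : Fun n} → Closed V → (∀ {x} → V x → F x ≡ G x) →
                     ∀ is {x} → V x → applyAll is F x ≡ applyAll is G x
  applyAll-cong-on closed F≡G [] vx = F≡G vx
  applyAll-cong-on closed F≡G (i ∷ is) vx =
    cong₂ _+_ (applyAll-cong-on closed F≡G is vx) (applyAll-cong-on closed F≡G is (closed i vx))

  applyAll-+ : ∀ is (F G : Fun n) x → applyAll is (λ v → F v + G v) x ≡ applyAll is F x + applyAll is G x
  applyAll-+ [] F G x = refl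
  applyAll-+ (i ∷ is) F G x =
    trans (cong₂ _+_ (applyAll-+ is F G x) (applyAll-+ is F G x′))
          (+-CS.interchange (applyAll is F x) (applyAll is G x) (applyAll is F x′) (applyAll is G x′))
    where
    x′ : Vector ℚ n
    x′ = updateAt x i inv

  applyAll-*ˡ : ∀ is c (F : Fun n) x → applyAll is (λ v → c * F v) x ≡ c * applyAll is F x
  applyAll-*ˡ [] c F x = refl
  applyAll-*ˡ (i ∷ is) c F x =
    trans (cong₂ _+_ (applyAll-*ˡ is c F x) (applyAll-*ˡ is c F (updateAt x i inv))) (sym (*-distribˡ-+ c _ _))

  applyAll-0 : ∀ (is : List (Fin n)) x → applyAll is (λ _ → 0ℚ) x ≡ 0ℚ
  applyAll-0 [] x = refl
  applyAll-0 (i ∷ is) x = cong₂ _+_ (applyAll-0 is x) (applyAll-0 is (updateAt x i inv))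

  applyAll-sum : ∀ is (K : Fin m → Fun n) x →
                 applyAll is (λ v → sum (λ k → K k v)) x ≡ sum (λ k → applyAll is (K k) x)
  applyAll-sum {m = zero} is K x = applyAll-0 is x
  applyAll-sum {m = suc m} is K x =
    trans (applyAll-+ is (K zero) (λ v → sum (λ k → K (suc k) v)) x)
          (cong (applyAll is (K zero) x +_) (applyAll-sum is (K ∘ suc) x))

  applyAll-antisymmetric : {V : Vector ℚ n → Set} {F : Fun n} → Closed V → Extensional F →
                           ∀ k → (∀ {x} → V x → F (updateAt x k inv) ≡ - F x) →
                           ∀ is {x} → V x → applyAll is F (updateAt x k inv) ≡ - applyAll is F x
  applyAll-antisymmetric closed ext k odd [] vx = odd vx
  applyAll-antisymmetric {F = F} closed ext k odd (j ∷ is) {x} vx = begin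
    A (updateAt x k inv) + A (updateAt (updateAt x k inv) j inv)
      ≡⟨ cong (A (updateAt x k inv) +_) (applyAll-extensional is ext (updateAt-comm j k x)) ⟩
    A (updateAt x k inv) + A (updateAt (updateAt x j inv) k inv)
      ≡⟨ cong₂ _+_ (applyAll-antisymmetric closed ext k odd is vx)
                   (applyAll-antisymmetric closed ext k odd is (closed j vx)) ⟩
    - A x + - A (updateAt x j inv)
      ≡⟨ neg-distrib-+ (A x) _ ⟨
    - (A x + A (updateAt x j inv))
      ∎
    where
    A : Fun n
    A = applyAll is F

  applyAll-vanishes : {V : Vector ℚ n → Set} {F : Fun n} → Closed V → Extensional F →
                      ∀ k → (∀ {x} → V x → F (updateAt x k inv) ≡ - F x) →
                      ∀ is → k ∈ is → ∀ {x} → V x → applyAll is F x ≡ 0ℚ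
  applyAll-vanishes {F = F} closed ext k odd (j ∷ is) (here refl) {x} vx =
    trans (cong (applyAll is F x +_) (applyAll-antisymmetric closed ext k odd is vx)) (+-inverseʳ (applyAll is F x))
  applyAll-vanishes closed ext k odd (j ∷ is) (there k∈is) vx =
    cong₂ _+_ (applyAll-vanishes closed ext k odd is k∈is vx) (applyAll-vanishes closed ext k odd is k∈is (closed j vx))

applyAll-map-suc : {F : Fun (suc n)} → Extensional F →
                   ∀ is x → applyAll (List.map suc is) F x ≡ applyAll is (λ v → F (head x ◂ v)) (tail x)
applyAll-map-suc ext [] x = ext (head-◂-tail x)
applyAll-map-suc ext (i ∷ is) x =
  cong₂ _+_ (applyAll-map-suc ext is x) (applyAll-map-suc ext is (updateAt x (suc i) inv))

applyAll-allFin-suc : {F : Fun (suc n)} → Extensional F → ∀ x →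
                      applyAll (allFin (suc n)) F x
                        ≡ applyAll (allFin n) (λ v → F (head x ◂ v) + F (inv (head x) ◂ v)) (tail x)
applyAll-allFin-suc {n} {F} ext x = begin
  applyAll (allFin (suc n)) F x
    ≡⟨ cong (λ is → applyAll (zero ∷ is) F x) (map-tabulate id suc) ⟨
  applyAll (List.map suc (allFin n)) F x + applyAll (List.map suc (allFin n)) F (updateAt x zero inv)
    ≡⟨ cong₂ _+_ (applyAll-map-suc ext (allFin n) x) (applyAll-map-suc ext (allFin n) (updateAt x zero inv)) ⟩
  applyAll (allFin n) (λ v → F (head x ◂ v)) (tail x) + applyAll (allFin n) (λ v → F (inv (head x) ◂ v)) (tail x)
    ≡⟨ applyAll-+ (allFin n) _ _ (tail x) ⟨
  applyAll (allFin n) (λ v → F (head x ◂ v) + F (inv (head x) ◂ v)) (tail x)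
    ∎

ifHolds : {P : Set} → Dec P → ℚ → ℚ
ifHolds (yes _) q = q
ifHolds (no _) q = 1ℚ

ifHolds-does : {P Q : Set} (p? : Dec P) (q? : Dec Q) (x : ℚ) → does p? ≡ does q? → ifHolds p? x ≡ ifHolds q? x
ifHolds-does (yes _) (yes _) q _ = refl
ifHolds-does (no _) (no _) q _ = refl
ifHolds-does (yes _) (no _) q ()
ifHolds-does (no _) (yes _) q ()

-- The left-hand side is the cell of prodPairs, a where-bound function of Defs that cannot be named.
prodPairs-cell : ∀ n (F : Fin n → Fin n → ℚ) i j → _ ≡ ifHolds (toℕ i ℕ.<? toℕ j) (F i j)

prodPairs-ifHolds : ∀ n F → prodPairs n F ≡ prodFin n (λ i → prodFin n (λ j → ifHolds (toℕ i ℕ.<? toℕ j) (F i j)))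
prodPairs-ifHolds n F = prodFin-cong (λ i → prodFin-cong (prodPairs-cell n F i))

prodPairs-cell n F i j with toℕ i ℕ.<? toℕ j
... | yes _ = refl
... | no _ = refl

prodPairs-suc : ∀ m (F : Fin (suc m) → Fin (suc m) → ℚ) →
                prodPairs (suc m) F ≡ prodFin m (λ j → F zero (suc j)) * prodPairs m (λ i j → F (suc i) (suc j))
prodPairs-suc m F = begin
  prodPairs (suc m) F
    ≡⟨ prodPairs-ifHolds (suc m) F ⟩
  1ℚ * prodFin m (λ j → F zero (suc j))
    * prodFin m (λ i → 1ℚ * prodFin m (λ j → ifHolds (suc (toℕ i) ℕ.<? suc (toℕ j)) (F (suc i) (suc j))))
    ≡⟨ cong₂ _*_ (*-identityˡ (prodFin m (λ j → F zero (suc j))))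
                 (prodFin-cong (λ i → trans (*-identityˡ _) (prodFin-cong (λ j →
                   ifHolds-does (suc (toℕ i) ℕ.<? suc (toℕ j)) (toℕ i ℕ.<? toℕ j) (F (suc i) (suc j)) refl)))) ⟩
  prodFin m (λ j → F zero (suc j)) * prodFin m (λ i → prodFin m (λ j → ifHolds (toℕ i ℕ.<? toℕ j) (F (suc i) (suc j))))
    ≡⟨ cong (prodFin m (λ j → F zero (suc j)) *_) (prodPairs-ifHolds m _) ⟨
  prodFin m (λ j → F zero (suc j)) * prodPairs m (λ i j → F (suc i) (suc j))
    ∎

module _ (t : ℚ) where

  factor : ℚ → ℚ
  factor z = (1ℚ - t * z) * inv (1ℚ - z)

  factor-identity : ∀ z I → I * (1ℚ - z) ≡ 1ℚ → (1ℚ - t * z) * I ≡ t + (1ℚ - t) * I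
  factor-identity z I I[1-z]≡1 = begin
    (1ℚ - t * z) * I                   ≡⟨ solve (t ∷ z ∷ I ∷ []) ℚ-ring ⟩
    t * (I * (1ℚ - z)) + (1ℚ - t) * I  ≡⟨ cong (λ e → t * e + (1ℚ - t) * I) I[1-z]≡1 ⟩
    t * 1ℚ + (1ℚ - t) * I              ≡⟨ solve (t ∷ I ∷ []) ℚ-ring ⟩
    t + (1ℚ - t) * I                   ∎

  factor-split : ∀ b y → y * b ≢ 1ℚ → factor (y * b) ≡ t + (1ℚ - t) * pole b y
  factor-split b y yb≢1 = factor-identity (y * b) (pole b y) (pole-inverse b y yb≢1)

  factor-at-0 : ∀ z → factor (0ℚ * z) ≡ 1ℚ
  factor-at-0 z = begin
    factor (0ℚ * z)     ≡⟨ cong factor (*-zeroˡ z) ⟩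
    (1ℚ - t * 0ℚ) * 1ℚ  ≡⟨ solve (t ∷ []) ℚ-ring ⟩
    1ℚ                  ∎

  pole-*-factor-identity : ∀ c Ua Ub Pa Pb → Ua * Ub ≡ Pa * Ub + Pb * Ua →
                           c * Ub * (t + (1ℚ - t) * Ua) ≡ c * (t + (1ℚ - t) * Pa) * Ub + (1ℚ - t) * (c * Pb) * Ua
  pole-*-factor-identity c Ua Ub Pa Pb UaUb≡ = begin
    c * Ub * (t + (1ℚ - t) * Ua)                         ≡⟨ solve (t ∷ c ∷ Ua ∷ Ub ∷ []) ℚ-ring ⟩
    c * (t * Ub + (1ℚ - t) * (Ua * Ub))                  ≡⟨ cong (λ e → c * (t * Ub + (1ℚ - t) * e)) UaUb≡ ⟩
    c * (t * Ub + (1ℚ - t) * (Pa * Ub + Pb * Ua))        ≡⟨ solve (t ∷ c ∷ Ua ∷ Ub ∷ Pa ∷ Pb ∷ []) ℚ-ring ⟩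
    c * (t + (1ℚ - t) * Pa) * Ub + (1ℚ - t) * (c * Pb) * Ua  ∎

  pole-*-factor : ∀ c a b y → a ≢ 0ℚ → b ≢ 0ℚ → b ≢ a → y * a ≢ 1ℚ → y * b ≢ 1ℚ →
                  c * pole b y * factor (y * a)
                    ≡ c * factor (inv b * a) * pole b y + (1ℚ - t) * (c * pole b (inv a)) * pole a y
  pole-*-factor c a b y a≢0 b≢0 b≢a ya≢1 yb≢1 = begin
    c * pole b y * factor (y * a)
      ≡⟨ cong (c * pole b y *_) (factor-split a y ya≢1) ⟩
    c * pole b y * (t + (1ℚ - t) * pole a y)
      ≡⟨ pole-*-factor-identity c (pole a y) (pole b y) (pole a (inv b)) (pole b (inv a))
           (partialFractions a b y a≢0 b≢0 (b≢a ∘ sym) ya≢1 yb≢1) ⟩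
    c * (t + (1ℚ - t) * pole a (inv b)) * pole b y + (1ℚ - t) * (c * pole b (inv a)) * pole a y
      ≡⟨ cong (λ e → c * e * pole b y + (1ℚ - t) * (c * pole b (inv a)) * pole a y)
              (factor-split a (inv b) (b≢a ∘ sym ∘ inv[p]*q≡1⇒q≡p b≢0)) ⟨
    c * factor (inv b * a) * pole b y + (1ℚ - t) * (c * pole b (inv a)) * pole a y
      ∎

  poleSum-*-factor : ∀ (c b : Vector ℚ m) a y → a ≢ 0ℚ → y * a ≢ 1ℚ →
                     (∀ k → b k ≢ 0ℚ) → (∀ k → b k ≢ a) → (∀ k → y * b k ≢ 1ℚ) →
                     poleSum c b y * factor (y * a)
                       ≡ poleSum (λ k → c k * factor (inv (b k) * a)) b y + (1ℚ - t) * poleSum c b (inv a) * pole a y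
  poleSum-*-factor {m} c b a y a≢0 ya≢1 b≢0 b≢a yb≢1 = begin
    poleSum c b y * factor (y * a)
      ≡⟨ *-distribʳ-sum (factor (y * a)) (λ k → c k * pole (b k) y) ⟩
    sum (λ k → c k * pole (b k) y * factor (y * a))
      ≡⟨ sum-cong-≗ (λ k → pole-*-factor (c k) a (b k) y a≢0 (b≢0 k) (b≢a k) ya≢1 (yb≢1 k)) ⟩
    sum (λ k → c′ k * pole (b k) y + (1ℚ - t) * (c k * pole (b k) (inv a)) * pole a y)
      ≡⟨ ∑-distrib-+ (λ k → c′ k * pole (b k) y) (λ k → (1ℚ - t) * (c k * pole (b k) (inv a)) * pole a y) ⟩
    poleSum c′ b y + sum (λ k → (1ℚ - t) * (c k * pole (b k) (inv a)) * pole a y)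
      ≡⟨ cong (poleSum c′ b y +_) (*-distribʳ-sum (pole a y) (λ k → (1ℚ - t) * (c k * pole (b k) (inv a)))) ⟨
    poleSum c′ b y + sum (λ k → (1ℚ - t) * (c k * pole (b k) (inv a))) * pole a y
      ≡⟨ cong (λ e → poleSum c′ b y + e * pole a y) (*-distribˡ-sum (1ℚ - t) (λ k → c k * pole (b k) (inv a))) ⟨
    poleSum c′ b y + (1ℚ - t) * poleSum c b (inv a) * pole a y
      ∎
    where
    c′ : Vector ℚ m
    c′ k = c k * factor (inv (b k) * a)

  row : (m : ℕ) → Vector ℚ m → ℚ → ℚ
  row m w y = factor (y * y) * prodFin m (λ k → factor (y * w k))

  row-cong : ∀ m {w w′ : Vector ℚ m} y → w ≗ w′ → row m w y ≡ row m w′ y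
  row-cong m y w≗w′ = cong (factor (y * y) *_) (prodFin-cong (λ k → cong (λ z → factor (y * z)) (w≗w′ k)))

  row-removeAt : ∀ m (w : Vector ℚ (suc m)) k y → row (suc m) w y ≡ row m (removeAt w k) y * factor (y * w k)
  row-removeAt m w k y =
    trans (cong (factor (y * y) *_) (prodFin-removeAt m (λ j → factor (y * w j)) k))
          (*-CS.x∙yz≈xz∙y (factor (y * y)) (factor (y * w k)) _)

  row-at-0 : ∀ m (w : Vector ℚ m) → row m w 0ℚ ≡ 1ℚ
  row-at-0 m w = cong₂ _*_ (factor-at-0 0ℚ) (prodFin-ones (λ k → factor-at-0 (w k)))

  Φ′ : (m : ℕ) → Vector ℚ m → ℚ
  Φ′ zero w = 1ℚ
  Φ′ (suc m) w = row m (tail w) (head w) * Φ′ m (tail w)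

  Φ′-cong : ∀ m → Extensional (Φ′ m)
  Φ′-cong zero w≗w′ = refl
  Φ′-cong (suc m) {w} {w′} w≗w′ =
    cong₂ _*_ (trans (cong (row m (tail w)) (w≗w′ zero)) (row-cong m (head w′) (w≗w′ ∘ suc))) (Φ′-cong m (w≗w′ ∘ suc))

  Φ≡Φ′ : ∀ n x → Φ n t x ≡ Φ′ n x
  Φ≡Φ′ zero x = refl
  Φ≡Φ′ (suc m) x = begin
    diagonal₀ * diagonal * prodPairs (suc m) F  ≡⟨ cong (diagonal₀ * diagonal *_) (prodPairs-suc m F) ⟩
    diagonal₀ * diagonal * (row₀ * pairs)       ≡⟨ *-CS.interchange diagonal₀ diagonal row₀ pairs ⟩
    diagonal₀ * row₀ * (diagonal * pairs)       ≡⟨ cong (diagonal₀ * row₀ *_) (Φ≡Φ′ m (tail x)) ⟩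
    Φ′ (suc m) x                                ∎
    where
    F : Fin (suc m) → Fin (suc m) → ℚ
    F i j = factor (x i * x j)
    diagonal₀ diagonal row₀ pairs : ℚ
    diagonal₀ = factor (x zero * x zero)
    diagonal = prodFin m (λ i → factor (x (suc i) * x (suc i)))
    row₀ = prodFin m (λ j → factor (x zero * x (suc j)))
    pairs = prodPairs m (λ i j → F (suc i) (suc j))

  Φ′-removeAt : ∀ m (w : Vector ℚ (suc m)) k → Φ′ (suc m) w ≡ row m (removeAt w k) (w k) * Φ′ m (removeAt w k)
  Φ′-removeAt m w zero = refl
  Φ′-removeAt (suc m) w (suc k) = begin
    row (suc m) v a * Φ′ (suc m) v
      ≡⟨ cong₂ _*_ (row-removeAt m v k a) (Φ′-removeAt m v k) ⟩
    row m r a * factor (a * b) * (row m r b * Φ′ m r)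
      ≡⟨ exchange (row m r a) (row m r b) (factor (a * b)) (Φ′ m r) ⟩
    row m r b * factor (a * b) * (row m r a * Φ′ m r)
      ≡⟨ cong (λ z → row m r b * factor z * (row m r a * Φ′ m r)) (*-comm a b) ⟩
    row m r b * factor (b * a) * (row m r a * Φ′ m r)
      ≡⟨ cong (_* (row m r a * Φ′ m r)) (row-removeAt m (a ◂ r) zero b) ⟨
    row (suc m) (a ◂ r) b * Φ′ (suc m) (a ◂ r)
      ≡⟨ cong₂ _*_ (row-cong (suc m) b (removeAt-suc w k)) (Φ′-cong (suc m) (removeAt-suc w k)) ⟨
    row (suc m) (removeAt w (suc k)) b * Φ′ (suc m) (removeAt w (suc k))
      ∎
    where
    a b : ℚ
    a = head w
    b = w (suc k)
    v : Vector ℚ (suc m)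
    v = tail w
    r : Vector ℚ m
    r = removeAt v k
    exchange : ∀ A B F P → A * F * (B * P) ≡ B * F * (A * P)
    exchange A B F P = solve (A ∷ B ∷ F ∷ P ∷ []) ℚ-ring

  residue : (m : ℕ) → Vector ℚ m → Vector ℚ m
  residue (suc m) w k = (1ℚ - t) * row m (removeAt w k) (inv (w k))

  residue-suc : ∀ m (w : Vector ℚ (suc m)) k →
                residue (suc m) w (suc k) ≡ residue m (tail w) k * factor (inv (tail w k) * head w)
  residue-suc (suc m) w k = begin
    (1ℚ - t) * row (suc m) (removeAt w (suc k)) b⁻¹
      ≡⟨ cong ((1ℚ - t) *_) (row-cong (suc m) b⁻¹ (removeAt-suc w k)) ⟩
    (1ℚ - t) * row (suc m) (head w ◂ r) b⁻¹
      ≡⟨ cong ((1ℚ - t) *_) (row-removeAt m (head w ◂ r) zero b⁻¹) ⟩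
    (1ℚ - t) * (row m r b⁻¹ * factor (b⁻¹ * head w))
      ≡⟨ *-assoc (1ℚ - t) (row m r b⁻¹) _ ⟨
    (1ℚ - t) * row m r b⁻¹ * factor (b⁻¹ * head w)
      ∎
    where
    b⁻¹ : ℚ
    b⁻¹ = inv (w (suc k))
    r : Vector ℚ m
    r = removeAt (tail w) k

  expansion-step-identity : ∀ C F Ua S₁ S₁′ S₁ᵃ S₂ S₂′ S₂ᵃ → F ≡ t + (1ℚ - t) * Ua →
                            S₁ * F ≡ S₁′ + (1ℚ - t) * S₁ᵃ * Ua → S₂ * F ≡ S₂′ + (1ℚ - t) * S₂ᵃ * Ua →
                            (C + S₁ + S₂) * F ≡ t * C + S₁′ + ((1ℚ - t) * (C + S₁ᵃ + S₂ᵃ) * Ua + S₂′)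
  expansion-step-identity C _ Ua S₁ S₁′ S₁ᵃ S₂ S₂′ S₂ᵃ refl h₁ h₂ = begin
    (C + S₁ + S₂) * (t + (1ℚ - t) * Ua)
      ≡⟨ solve (t ∷ C ∷ Ua ∷ S₁ ∷ S₂ ∷ []) ℚ-ring ⟩
    C * (t + (1ℚ - t) * Ua) + S₁ * (t + (1ℚ - t) * Ua) + S₂ * (t + (1ℚ - t) * Ua)
      ≡⟨ cong₂ (λ p q → C * (t + (1ℚ - t) * Ua) + p + q) h₁ h₂ ⟩
    C * (t + (1ℚ - t) * Ua) + (S₁′ + (1ℚ - t) * S₁ᵃ * Ua) + (S₂′ + (1ℚ - t) * S₂ᵃ * Ua)
      ≡⟨ solve (t ∷ C ∷ Ua ∷ S₁′ ∷ S₁ᵃ ∷ S₂′ ∷ S₂ᵃ ∷ []) ℚ-ring ⟩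
    t * C + S₁′ + ((1ℚ - t) * (C + S₁ᵃ + S₂ᵃ) * Ua + S₂′)
      ∎

  RowExpansion : (m : ℕ) → Vector ℚ m → Vector ℚ 2 → Set
  RowExpansion m w p =
    ∀ y → AvoidsPoles w y → row m w y ≡ pow t (suc m) + poleSum p signs y + poleSum (residue m w) w y

  factor-square-split : ∀ y → (∀ k → y * signs k ≢ 1ℚ) →
                        factor (y * y) ≡ t + (1ℚ - t) * (½ * pole 1ℚ y + ½ * pole (- 1ℚ) y)
  factor-square-split y ys≢1 = begin
    (1ℚ - t * (y * y)) * inv (1ℚ - y * y)  ≡⟨ cong ((1ℚ - t * (y * y)) *_) (inv-unique (1ℚ - y * y) [1-y²]J≡1) ⟩
    (1ℚ - t * (y * y)) * J                 ≡⟨ factor-identity (y * y) J (trans (*-comm J _) [1-y²]J≡1) ⟩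
    t + (1ℚ - t) * J                       ∎
    where
    J : ℚ
    J = ½ * pole 1ℚ y + ½ * pole (- 1ℚ) y
    [1-y²]J≡1 : (1ℚ - y * y) * J ≡ 1ℚ
    [1-y²]J≡1 = inv[1-y²]-identity y (pole 1ℚ y) (pole (- 1ℚ) y)
                  (pole-inverse 1ℚ y (ys≢1 zero)) (pole-inverse (- 1ℚ) y (ys≢1 (suc zero)))

  row-expansion-zero : (w : Vector ℚ 0) → RowExpansion 0 w (λ _ → (1ℚ - t) * ½)
  row-expansion-zero w y (ys≢1 , _) = begin
    factor (y * y) * 1ℚ                                   ≡⟨ *-identityʳ (factor (y * y)) ⟩
    factor (y * y)                                        ≡⟨ factor-square-split y ys≢1 ⟩
    t + (1ℚ - t) * (½ * pole 1ℚ y + ½ * pole (- 1ℚ) y)    ≡⟨ distribute (pole 1ℚ y) (pole (- 1ℚ) y) ⟩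
    t * 1ℚ + poleSum (λ _ → (1ℚ - t) * ½) signs y + 0ℚ    ∎
    where
    distribute : ∀ U₊ U₋ → t + (1ℚ - t) * (½ * U₊ + ½ * U₋)
                             ≡ t * 1ℚ + ((1ℚ - t) * ½ * U₊ + ((1ℚ - t) * ½ * U₋ + 0ℚ)) + 0ℚ
    distribute U₊ U₋ = solve (t ∷ U₊ ∷ U₋ ∷ []) ℚ-ring

  -- The new pole a gets coefficient (1 - t) times the old expansion evaluated at y = 1/a,
  -- which is (1 - t) row m v (1/a), the residue at a.
  row-expansion-suc : ∀ m (w : Vector ℚ (suc m)) {p} → Generic w → RowExpansion m (tail w) p →
                      RowExpansion (suc m) w (λ k → p k * factor (inv (signs k) * head w))
  row-expansion-suc m w {p} (regular , injective) expand-v y (ys≢1 , yw≢1) = begin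
    row (suc m) w y
      ≡⟨ row-removeAt m w zero y ⟩
    row m v y * factor (y * a)
      ≡⟨ cong (_* factor (y * a)) (expand-v y (ys≢1 , yw≢1 ∘ suc)) ⟩
    (C + poleSum p signs y + poleSum c v y) * factor (y * a)
      ≡⟨ expansion-step-identity C (factor (y * a)) (pole a y)
           (poleSum p signs y) (poleSum p′ signs y) (poleSum p signs (inv a))
           (poleSum c v y) (poleSum c′ v y) (poleSum c v (inv a))
           (factor-split a y (yw≢1 zero))
           (poleSum-*-factor p signs a y a≢0 (yw≢1 zero) signs-≢0 (signs-≢-regular (regular zero)) ys≢1)
           (poleSum-*-factor c v a y a≢0 (yw≢1 zero) (proj₁ ∘ regular ∘ suc) v≢a (yw≢1 ∘ suc)) ⟩
    t * C + poleSum p′ signs y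
      + ((1ℚ - t) * (C + poleSum p signs (inv a) + poleSum c v (inv a)) * pole a y + poleSum c′ v y)
      ≡⟨ cong (λ e → t * C + poleSum p′ signs y + ((1ℚ - t) * e * pole a y + poleSum c′ v y))
              (expand-v (inv a) avoids[a⁻¹]) ⟨
    t * C + poleSum p′ signs y + ((1ℚ - t) * row m v (inv a) * pole a y + poleSum c′ v y)
      ≡⟨ cong (λ e → t * C + poleSum p′ signs y + ((1ℚ - t) * row m v (inv a) * pole a y + e))
              (sum-cong-≗ (λ k → cong (_* pole (v k) y) (residue-suc m w k))) ⟨
    t * C + poleSum p′ signs y + poleSum (residue (suc m) w) w y
      ∎
    where
    a : ℚ
    a = head w
    v : Vector ℚ m
    v = tail w
    a≢0 : a ≢ 0ℚ
    a≢0 = proj₁ (regular zero)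
    v≢a : ∀ k → v k ≢ a
    v≢a k = injective (suc k) zero λ ()
    avoids[a⁻¹] : AvoidsPoles v (inv a)
    avoids[a⁻¹] = (λ k → signs-≢-regular (regular zero) k ∘ inv[p]*q≡1⇒q≡p a≢0)
                , (λ k → v≢a k ∘ inv[p]*q≡1⇒q≡p a≢0)
    C : ℚ
    C = pow t (suc m)
    p′ : Vector ℚ 2
    p′ k = p k * factor (inv (signs k) * a)
    c c′ : Vector ℚ m
    c = residue m v
    c′ k = c k * factor (inv (v k) * a)

  row-expansion : ∀ m (w : Vector ℚ m) → Generic w → Σ[ p ∈ Vector ℚ 2 ] RowExpansion m w p
  row-expansion zero w _ = (λ _ → (1ℚ - t) * ½) , row-expansion-zero w
  row-expansion (suc m) w generic with row-expansion m (tail w) (Generic-tail generic)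
  ... | p , expand-v = (λ k → p k * factor (inv (signs k) * head w)) , row-expansion-suc m w {p} generic expand-v

  row-symmetrization : ∀ m (v : Vector ℚ m) y → Generic v → y ≢ 0ℚ → AvoidsPoles v y → AvoidsPoles v (inv y) →
                       row m v y + row m v (inv y) ≡ pow t (suc m) + 1ℚ + sum (λ k → residue m v k * defect (v k) y)
  row-symmetrization m v y generic y≢0 avoids[y] avoids[y⁻¹] with row-expansion m v generic
  ... | p , expand = begin
    row m v y + row m v (inv y)
      ≡⟨ cong₂ _+_ (expand y avoids[y]) (expand (inv y) avoids[y⁻¹]) ⟩
    (C + poleSum p signs y + poleSum c v y) + (C + poleSum p signs (inv y) + poleSum c v (inv y))
      ≡⟨ symmetrization-identity C _ _ _ _ (sum p) (sum c) _ signs-part (poleSum-symmetrization c v y) at-0 ⟩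
    C + 1ℚ + sum (λ k → c k * defect (v k) y)
      ∎
    where
    C : ℚ
    C = pow t (suc m)
    c : Vector ℚ m
    c = residue m v
    signs-part : poleSum p signs y + poleSum p signs (inv y) ≡ sum p
    signs-part = begin
      poleSum p signs y + poleSum p signs (inv y)     ≡⟨ poleSum-symmetrization p signs y ⟩
      sum p + sum (λ k → p k * defect (signs k) y)    ≡⟨ cong (sum p +_) defects-vanish ⟩
      sum p + 0ℚ                                      ≡⟨ +-identityʳ (sum p) ⟩
      sum p                                           ∎
      where
      defect-sign : ∀ k → defect (signs k) y ≡ 0ℚ
      defect-sign k = defect-self-reciprocal (signs k) y (signs-self-reciprocal k) (signs-≢0 k) y≢0 (proj₁ avoids[y] k)
      defects-vanish : sum (λ k → p k * defect (signs k) y) ≡ 0ℚ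
      defects-vanish = trans (sum-cong-≗ (λ k → trans (cong (p k *_) (defect-sign k)) (*-zeroʳ (p k))))
                             (sum-replicate-zero 2)
    at-0 : C + sum p + sum c ≡ 1ℚ
    at-0 = begin
      C + sum p + sum c                        ≡⟨ cong₂ (λ e f → C + e + f) (poleSum-at-0 p signs) (poleSum-at-0 c v) ⟨
      C + poleSum p signs 0ℚ + poleSum c v 0ℚ  ≡⟨ expand 0ℚ ((λ k → 0*p≢1 (signs k)) , (λ k → 0*p≢1 (v k))) ⟨
      row m v 0ℚ                               ≡⟨ row-at-0 m v ⟩
      1ℚ                                       ∎

  oddTerm : ∀ m → ℚ → Fin m → Vector ℚ m → ℚ
  oddTerm m y k v = defect (v k) y * (residue m v k * Φ′ m v)

  Φ′-symmetrization : ∀ m y (v : Vector ℚ m) → Admissible (y ◂ v) →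
                      Φ′ (suc m) (y ◂ v) + Φ′ (suc m) (inv y ◂ v)
                        ≡ (pow t (suc m) + 1ℚ) * Φ′ m v + sum (λ k → oddTerm m y k v)
  Φ′-symmetrization m y v admissible = begin
    row m v y * Φ′ m v + row m v (inv y) * Φ′ m v
      ≡⟨ *-distribʳ-+ (Φ′ m v) (row m v y) _ ⟨
    (row m v y + row m v (inv y)) * Φ′ m v
      ≡⟨ cong (_* Φ′ m v) (row-symmetrization m v y (Admissible⇒Generic (Admissible-tail admissible)) (proj₁ regular)
           (avoidsPoles regular apart) (avoidsPoles (Regular-inv regular) (Apart-inv ∘ apart))) ⟩
    (pow t (suc m) + 1ℚ + sum (λ k → residue m v k * defect (v k) y)) * Φ′ m v
      ≡⟨ *-distribʳ-+ (Φ′ m v) (pow t (suc m) + 1ℚ) _ ⟩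
    (pow t (suc m) + 1ℚ) * Φ′ m v + sum (λ k → residue m v k * defect (v k) y) * Φ′ m v
      ≡⟨ cong ((pow t (suc m) + 1ℚ) * Φ′ m v +_) (*-distribʳ-sum (Φ′ m v) (λ k → residue m v k * defect (v k) y)) ⟩
    (pow t (suc m) + 1ℚ) * Φ′ m v + sum (λ k → residue m v k * defect (v k) y * Φ′ m v)
      ≡⟨ cong ((pow t (suc m) + 1ℚ) * Φ′ m v +_) (sum-cong-≗ (λ k → *-CS.xy∙z≈y∙xz (residue m v k) _ _)) ⟩
    (pow t (suc m) + 1ℚ) * Φ′ m v + sum (λ k → oddTerm m y k v)
      ∎
    where
    regular : Regular y
    regular = proj₁ admissible zero
    apart : ∀ k → Apart y (v k)
    apart k = proj₂ admissible zero (suc k) λ ()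

  residue-Φ′ : ∀ m (v : Vector ℚ (suc m)) k →
               residue (suc m) v k * Φ′ (suc m) v
                 ≡ (1ℚ - t) * (row m (removeAt v k) (inv (v k)) * row m (removeAt v k) (v k)) * Φ′ m (removeAt v k)
  residue-Φ′ m v k = begin
    (1ℚ - t) * R⁻ * Φ′ (suc m) v   ≡⟨ cong ((1ℚ - t) * R⁻ *_) (Φ′-removeAt m v k) ⟩
    (1ℚ - t) * R⁻ * (R⁺ * Φ′ m r)  ≡⟨ *-assoc ((1ℚ - t) * R⁻) R⁺ (Φ′ m r) ⟨
    (1ℚ - t) * R⁻ * R⁺ * Φ′ m r    ≡⟨ cong (_* Φ′ m r) (*-assoc (1ℚ - t) R⁻ R⁺) ⟩
    (1ℚ - t) * (R⁻ * R⁺) * Φ′ m r  ∎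
    where
    r : Vector ℚ m
    r = removeAt v k
    R⁻ R⁺ : ℚ
    R⁻ = row m r (inv (v k))
    R⁺ = row m r (v k)

  residue-Φ′-reflect : ∀ m (v : Vector ℚ (suc m)) k →
                       residue (suc m) (updateAt v k inv) k * Φ′ (suc m) (updateAt v k inv)
                         ≡ residue (suc m) v k * Φ′ (suc m) v
  residue-Φ′-reflect m v k = begin
    residue (suc m) v′ k * Φ′ (suc m) v′
      ≡⟨ residue-Φ′ m v′ k ⟩
    (1ℚ - t) * (row m r′ (inv (v′ k)) * row m r′ (v′ k)) * Φ′ m r′
      ≡⟨ cong₂ (λ p q → (1ℚ - t) * p * q)
               (cong₂ _*_ (row-cong m (inv (v′ k)) (removeAt-updateAt v k)) (row-cong m (v′ k) (removeAt-updateAt v k)))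
               (Φ′-cong m (removeAt-updateAt v k)) ⟩
    (1ℚ - t) * (row m r (inv (v′ k)) * row m r (v′ k)) * Φ′ m r
      ≡⟨ cong (λ b → (1ℚ - t) * (row m r (inv b) * row m r b) * Φ′ m r) (updateAt-updates k v) ⟩
    (1ℚ - t) * (row m r (inv (inv a)) * row m r (inv a)) * Φ′ m r
      ≡⟨ cong (λ b → (1ℚ - t) * (row m r b * row m r (inv a)) * Φ′ m r) (inv-involutive a) ⟩
    (1ℚ - t) * (row m r a * row m r (inv a)) * Φ′ m r
      ≡⟨ cong (λ e → (1ℚ - t) * e * Φ′ m r) (*-comm (row m r a) _) ⟩
    (1ℚ - t) * (row m r (inv a) * row m r a) * Φ′ m r
      ≡⟨ residue-Φ′ m v k ⟨
    residue (suc m) v k * Φ′ (suc m) v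
      ∎
    where
    a : ℚ
    a = v k
    v′ : Vector ℚ (suc m)
    v′ = updateAt v k inv
    r r′ : Vector ℚ m
    r = removeAt v k
    r′ = removeAt v′ k

  oddTerm-reflect : ∀ m y k (v : Vector ℚ m) → Admissible (y ◂ v) → oddTerm m y k (updateAt v k inv) ≡ - oddTerm m y k v
  oddTerm-reflect (suc m) y k v admissible = begin
    defect (updateAt v k inv k) y * (residue (suc m) (updateAt v k inv) k * Φ′ (suc m) (updateAt v k inv))
      ≡⟨ cong₂ _*_ (cong (λ b → defect b y) (updateAt-updates k v)) (residue-Φ′-reflect m v k) ⟩
    defect (inv (v k)) y * (residue (suc m) v k * Φ′ (suc m) v)
      ≡⟨ cong (_* (residue (suc m) v k * Φ′ (suc m) v))
              (defect-reflect (v k) y (proj₁ (proj₁ admissible (suc k))) (proj₁ (proj₁ admissible zero))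
                              (proj₁ y-apart) (proj₁ (Apart-inv y-apart))) ⟩
    - defect (v k) y * (residue (suc m) v k * Φ′ (suc m) v)
      ≡⟨ neg-distribˡ-* (defect (v k) y) _ ⟨
    - oddTerm (suc m) y k v
      ∎
    where
    y-apart : Apart y (v k)
    y-apart = proj₂ admissible zero (suc k) λ ()

  oddTerm-extensional : ∀ m y k → Extensional (oddTerm m y k)
  oddTerm-extensional (suc m) y k {v} {v′} v≗v′ =
    cong₂ _*_ (cong (λ b → defect b y) (v≗v′ k))
              (cong₂ _*_ (cong ((1ℚ - t) *_) (trans (row-cong m (inv (v k)) (v≗v′ ∘ punchIn k))
                                                    (cong (row m (removeAt v′ k) ∘ inv) (v≗v′ k))))
                         (Φ′-cong (suc m) v≗v′))

  rhs-suc : ∀ m → rhs (suc m) t ≡ rhs m t * (pow t (suc m) + 1ℚ)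
  rhs-suc m = trans (prodFin-init-last m (λ i → pow t (suc (toℕ i)) + 1ℚ))
                    (cong₂ _*_ (prodFin-cong {n = m} (λ i → cong (λ n → pow t (suc n) + 1ℚ) (Fin.toℕ-inject₁ i)))
                               (cong (λ n → pow t (suc n) + 1ℚ) (Fin.toℕ-fromℕ m)))

  applyAll-Φ′ : ∀ m (x : Vector ℚ m) → Admissible x → applyAll (allFin m) (Φ′ m) x ≡ rhs m t
  applyAll-Φ′ zero x _ = refl
  applyAll-Φ′ (suc m) x admissible = begin
    applyAll (allFin (suc m)) (Φ′ (suc m)) x
      ≡⟨ applyAll-allFin-suc (Φ′-cong (suc m)) x ⟩
    applyAll (allFin m) (λ v → Φ′ (suc m) (y ◂ v) + Φ′ (suc m) (inv y ◂ v)) z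
      ≡⟨ applyAll-cong-on closed (Φ′-symmetrization m y _) (allFin m) admissible[y◂z] ⟩
    applyAll (allFin m) (λ v → C * Φ′ m v + sum (λ k → oddTerm m y k v)) z
      ≡⟨ applyAll-+ (allFin m) (λ v → C * Φ′ m v) _ z ⟩
    applyAll (allFin m) (λ v → C * Φ′ m v) z + applyAll (allFin m) (λ v → sum (λ k → oddTerm m y k v)) z
      ≡⟨ cong₂ _+_ (applyAll-*ˡ (allFin m) C (Φ′ m) z) (applyAll-sum (allFin m) (λ k → oddTerm m y k) z) ⟩
    C * applyAll (allFin m) (Φ′ m) z + sum (λ k → applyAll (allFin m) (oddTerm m y k) z)
      ≡⟨ cong₂ _+_ (cong (C *_) (applyAll-Φ′ m z (Admissible-tail admissible)))
                   (trans (sum-cong-≗ odd-vanish) (sum-replicate-zero m)) ⟩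
    C * rhs m t + 0ℚ
      ≡⟨ trans (+-identityʳ _) (*-comm C (rhs m t)) ⟩
    rhs m t * C
      ≡⟨ rhs-suc m ⟨
    rhs (suc m) t
      ∎
    where
    y : ℚ
    y = head x
    z : Vector ℚ m
    z = tail x
    C : ℚ
    C = pow t (suc m) + 1ℚ
    closed : Closed (λ v → Admissible (y ◂ v))
    closed i {v} = Admissible-resp-≗ (updateAt-suc y v i) ∘ Admissible-updateAt (suc i)
    admissible[y◂z] : Admissible (y ◂ z)
    admissible[y◂z] = Admissible-resp-≗ (head-◂-tail x) admissible
    odd-vanish : ∀ k → applyAll (allFin m) (oddTerm m y k) z ≡ 0ℚ
    odd-vanish k = applyAll-vanishes closed (oddTerm-extensional m y k) k (oddTerm-reflect m y k _)
                                     (allFin m) (∈-allFin k) admissible[y◂z]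

-- The identity also holds for n = 0.
lemma8 : (n : ℕ) → 1 ≤ n → (t : ℚ) → (x : Fin n → ℚ)
    → (∀ i → x i ≢ 0ℚ)
    → (∀ i → x i * x i ≢ 1ℚ)
    → (∀ i j → i ≢ j → x i * x j ≢ 1ℚ)
    → (∀ i j → i ≢ j → x i ≢ x j)
    → applyAll (allFin n) (Φ n t) x ≡ rhs n t
lemma8 n _ t x nonzero square≢1 product≢1 distinct = begin
  applyAll (allFin n) (Φ n t) x
    ≡⟨ applyAll-cong-on (λ i {v} → Admissible-updateAt {x = v} i) (λ {v} _ → Φ≡Φ′ t n v) (allFin n) admissible ⟩
  applyAll (allFin n) (Φ′ t n) x
    ≡⟨ applyAll-Φ′ t n x admissible ⟩
  rhs n t
    ∎
  where
  admissible : Admissible x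
  admissible = (λ i → nonzero i , square≢1 i) , (λ i j i≢j → product≢1 i j i≢j , distinct i j i≢j)
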